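{- Let $p\ge 5$ be a prime. Define integers $s_1,s_2,\dots$ by $s_1=1$ and $s_i=(2i-2)(2i+1)s_{i-1}+1$ for $i\ge 2$ (equivalently, $s_k=\sum_{i=1}^{k}\frac{i}{k}\frac{(2k+1)!}{(2i+1)!}$). Then $$0!+1!+\cdots+(p-1)!\equiv 1+3\,s_{\frac{p-3}{2}} \pmod p.$$ -}

module Defs where

open import Data.Nat using (ℕ; zero; suc; _+_; _*_; _∸_; _!)
open import Data.Nat.ListAction using (sum)
open import Data.List using (map; upTo)

-- s i for i ≥ 1: s 1 = 1, s i = (2i-2)(2i+1) s (i-1) + 1 for i ≥ 2.
-- s 0 is an unused dummy value (0).
s : ℕ → ℕ
s zero = 0
s (suc zero) = 1
s (suc (suc k)) = ((2 * i ∸ 2) * (2 * i + 1)) * s (suc k) + 1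
  where
  i : ℕ
  i = suc (suc k)

factSum : ℕ → ℕ
factSum n = sum (map (λ k → k !) (upTo n))

module Submission where

-- Write p = 2m + 3 with m = (p - 3)/2 ≥ 1.  Grouping the factorials in pairs,
--   0! + 1! + ... + (p-1)!  =  1 + Σ_{b=0}^{m} ((2b+1)! + (2b+2)!),
-- and the b-th pair equals (2b+3)·(2b+1)!.  Hence the last pair (b = m) is
-- divisible by p, and consecutive pairs have ratio (2b+5)(2b+2), so the
-- remaining sum Σ_{b<m} is the Horner expression
--   3 · (1 + 5·2·(1 + 7·4·(1 + ...))),
-- where the first pair is 1! + 2! = 3.  The recursion for s builds the same
-- Horner expression from the inside out, with factors (2i-2)(2i+1); modulo
-- p = 2m + 3 these factors are (-(2b+5))·(-(2b+2)) for b = m - i, so the two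
-- expressions agree modulo p.

open import Defs
open import Data.Nat using (ℕ; zero; suc; _+_; _*_; _∸_; _/_; _%_; _!; _≤_; _<_; s≤s; z≤n; NonZero)
open import Data.Nat.Properties using (+-comm; +-suc; +-assoc; +-identityʳ; *-comm; *-distribˡ-+; *-distribʳ-+; *-assoc; *-identityʳ; <⇒≱)
open import Data.Nat.DivMod using (%-distribˡ-+; %-distribˡ-*; %-remove-+ʳ; [m+kn]%n≡m%n; m*n/n≡m; m≡m%n+[m/n]*n; m%n<n)
open import Data.Nat.Divisibility using (_∣_; divides)
open import Data.Nat.Primality using (Prime; prime⇒nonZero; prime⇒irreducible)
open import Data.Nat.ListAction using (sum)
open import Data.Nat.ListAction.Properties using (sum-++)
open import Data.List using (map; upTo; [_]; _++_)
open import Data.List.Properties using (upTo-∷ʳ; map-++)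
open import Data.Nat.Tactic.RingSolver using (solve-∀)
open import Data.Product using (∃; _,_)
open import Data.Sum using (inj₁; inj₂)
open import Data.Empty using (⊥-elim)
open import Relation.Binary.PropositionalEquality using (_≡_; refl; sym; trans; cong; cong₂; subst; module ≡-Reasoning)
open ≡-Reasoning

sumFrom : (ℕ → ℕ) → ℕ → ℕ → ℕ
sumFrom f b zero    = f b
sumFrom f b (suc r) = f b + sumFrom f (suc b) r

sumFrom-snoc : ∀ f b r → sumFrom f b (suc r) ≡ sumFrom f b r + f (b + suc r)
sumFrom-snoc f b zero = cong (λ k → f b + f k) (+-comm 1 b)
sumFrom-snoc f b (suc r) = begin
  f b + sumFrom f (suc b) (suc r)                 ≡⟨ cong (f b +_) (sumFrom-snoc f (suc b) r) ⟩
  f b + (sumFrom f (suc b) r + f (suc b + suc r)) ≡⟨ +-assoc (f b) _ _ ⟨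
  f b + sumFrom f (suc b) r + f (suc b + suc r)   ≡⟨ cong (λ k → f b + sumFrom f (suc b) r + f k) (+-suc b (suc r)) ⟨
  f b + sumFrom f (suc b) r + f (b + suc (suc r)) ∎

horner : (ℕ → ℕ) → ℕ → ℕ → ℕ
horner d b zero    = 1
horner d b (suc r) = 1 + d b * horner d (suc b) r

sumFrom-horner : ∀ f d → (∀ b → f (suc b) ≡ d b * f b) →
                 ∀ b r → sumFrom f b r ≡ f b * horner d b r
sumFrom-horner f d ratio b zero = sym (*-identityʳ (f b))
sumFrom-horner f d ratio b (suc r) = begin
  f b + sumFrom f (suc b) r                  ≡⟨ cong (f b +_) (sumFrom-horner f d ratio (suc b) r) ⟩
  f b + f (suc b) * horner d (suc b) r       ≡⟨ cong (λ x → f b + x * horner d (suc b) r) (trans (ratio b) (*-comm (d b) (f b))) ⟩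
  f b + f b * d b * horner d (suc b) r       ≡⟨ cong₂ _+_ (*-identityʳ (f b)) (sym (*-assoc (f b) (d b) _)) ⟨
  f b * 1 + f b * (d b * horner d (suc b) r) ≡⟨ *-distribˡ-+ (f b) 1 _ ⟨
  f b * (1 + d b * horner d (suc b) r)       ∎

factSum-suc : ∀ n → factSum (suc n) ≡ factSum n + n !
factSum-suc n = begin
  sum (map _! (upTo (suc n)))             ≡⟨ cong (λ l → sum (map _! l)) (upTo-∷ʳ n) ⟨
  sum (map _! (upTo n ++ [ n ]))          ≡⟨ cong sum (map-++ _! (upTo n) [ n ]) ⟩
  sum (map _! (upTo n) ++ [ n ! ])        ≡⟨ sum-++ (map _! (upTo n)) [ n ! ] ⟩
  factSum n + (n ! + 0)                   ≡⟨ cong (factSum n +_) (+-identityʳ (n !)) ⟩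
  factSum n + n !                         ∎

factSum-suc-suc : ∀ n → factSum (suc (suc n)) ≡ factSum n + (n ! + suc n !)
factSum-suc-suc n = begin
  factSum (suc (suc n))          ≡⟨ factSum-suc (suc n) ⟩
  factSum (suc n) + suc n !      ≡⟨ cong (_+ suc n !) (factSum-suc n) ⟩
  factSum n + n ! + suc n !      ≡⟨ +-assoc (factSum n) (n !) (suc n !) ⟩
  factSum n + (n ! + suc n !)    ∎

pair : ℕ → ℕ
pair b = (2 * b + 1) ! + suc (2 * b + 1) !

pair-closed : ∀ b → pair b ≡ (2 * b + 3) * (2 * b + 1) !
pair-closed b = identity (2 * b) ((2 * b + 1) !)
  where
  identity : ∀ k x → x + (x + (k + 1) * x) ≡ (k + 3) * x
  identity = solve-∀

-- Ratio of consecutive pairs: by the closed form,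
-- pair (b+1) = (2b+5)·(2b+3)! = (2b+5)(2b+2)·((2b+3)·(2b+1)!) = (2b+5)(2b+2)·pair b.
pairRatio : ℕ → ℕ
pairRatio b = (2 * b + 5) * (2 * b + 2)

pair-step : ∀ b → pair (suc b) ≡ pairRatio b * pair b
pair-step b = begin
  pair (suc b)                                     ≡⟨ pair-closed (suc b) ⟩
  (2 * suc b + 3) * (2 * suc b + 1) !              ≡⟨ cong (λ k → (2 * suc b + 3) * k !) (index b) ⟩
  (2 * suc b + 3) * suc (suc (2 * b + 1)) !        ≡⟨ identity b ((2 * b + 1) !) ⟩
  pairRatio b * ((2 * b + 3) * (2 * b + 1) !)      ≡⟨ cong (pairRatio b *_) (pair-closed b) ⟨
  pairRatio b * pair b                             ∎
  where
  index : ∀ b → 2 * suc b + 1 ≡ suc (suc (2 * b + 1))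
  index = solve-∀
  identity : ∀ b x → (2 * suc b + 3) * (suc (suc (2 * b + 1)) * (suc (2 * b + 1) * x))
                     ≡ ((2 * b + 5) * (2 * b + 2)) * ((2 * b + 3) * x)
  identity = solve-∀

factSum-pairs : ∀ r → factSum (3 + 2 * r) ≡ 1 + sumFrom pair 0 r
factSum-pairs zero = refl
factSum-pairs (suc r) = begin
  factSum (3 + 2 * suc r)                               ≡⟨ cong factSum (length r) ⟩
  factSum (suc (suc (3 + 2 * r)))                       ≡⟨ factSum-suc-suc (3 + 2 * r) ⟩
  factSum (3 + 2 * r) + ((3 + 2 * r) ! + (4 + 2 * r) !) ≡⟨ cong₂ _+_ (factSum-pairs r) (cong (λ k → k ! + suc k !) (index r)) ⟩
  1 + sumFrom pair 0 r + pair (suc r)                   ≡⟨ +-assoc 1 (sumFrom pair 0 r) (pair (suc r)) ⟩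
  1 + (sumFrom pair 0 r + pair (suc r))                 ≡⟨ cong (1 +_) (sumFrom-snoc pair 0 r) ⟨
  1 + sumFrom pair 0 (suc r)                            ∎
  where
  length : ∀ r → 3 + 2 * suc r ≡ suc (suc (3 + 2 * r))
  length = solve-∀
  index : ∀ r → 3 + 2 * r ≡ 2 * suc r + 1
  index = solve-∀

pair-divisible : ∀ m → (2 * m + 3) ∣ pair m
pair-divisible m = divides ((2 * m + 1) !) (trans (pair-closed m) (*-comm (2 * m + 3) _))

+-cong-% : ∀ {a b c e} n .{{_ : NonZero n}} → a % n ≡ b % n → c % n ≡ e % n → (a + c) % n ≡ (b + e) % n
+-cong-% {a} {b} {c} {e} n a≡b c≡e = begin
  (a + c) % n             ≡⟨ %-distribˡ-+ a c n ⟩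
  (a % n + c % n) % n     ≡⟨ cong₂ (λ x y → (x + y) % n) a≡b c≡e ⟩
  (b % n + e % n) % n     ≡⟨ %-distribˡ-+ b e n ⟨
  (b + e) % n             ∎

*-cong-% : ∀ {a b c e} n .{{_ : NonZero n}} → a % n ≡ b % n → c % n ≡ e % n → (a * c) % n ≡ (b * e) % n
*-cong-% {a} {b} {c} {e} n a≡b c≡e = begin
  (a * c) % n             ≡⟨ %-distribˡ-* a c n ⟩
  (a % n * (c % n)) % n   ≡⟨ cong₂ (λ x y → (x * y) % n) a≡b c≡e ⟩
  (b % n * (e % n)) % n   ≡⟨ %-distribˡ-* b e n ⟨
  (b * e) % n             ∎

-- (-a₁)(-a₂) ≡ a₁a₂ (mod n): if c₁ + a₁ = n and c₂ + a₂ = n then c₁c₂ ≡ a₁a₂.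
complements-product : ∀ c₁ c₂ a₁ a₂ n .{{_ : NonZero n}} →
                      c₁ + a₁ ≡ n → c₂ + a₂ ≡ n → (c₁ * c₂) % n ≡ (a₁ * a₂) % n
complements-product c₁ c₂ a₁ a₂ n e₁ e₂ = begin
  (c₁ * c₂) % n                                     ≡⟨ [m+kn]%n≡m%n (c₁ * c₂) (a₁ + a₂) n ⟨
  (c₁ * c₂ + (a₁ + a₂) * n) % n                     ≡⟨ cong (λ z → (c₁ * c₂ + z) % n) (*-distribʳ-+ n a₁ a₂) ⟩
  (c₁ * c₂ + (a₁ * n + a₂ * n)) % n                 ≡⟨ cong₂ (λ x y → (c₁ * c₂ + (a₁ * x + a₂ * y)) % n) (sym e₂) (sym e₁) ⟩
  (c₁ * c₂ + (a₁ * (c₂ + a₂) + a₂ * (c₁ + a₁))) % n ≡⟨ cong (_% n) (expand c₁ c₂ a₁ a₂) ⟩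
  (a₁ * a₂ + (c₁ + a₁) * (c₂ + a₂)) % n             ≡⟨ cong₂ (λ x y → (a₁ * a₂ + x * y) % n) e₁ e₂ ⟩
  (a₁ * a₂ + n * n) % n                             ≡⟨ [m+kn]%n≡m%n (a₁ * a₂) n n ⟩
  (a₁ * a₂) % n                                     ∎
  where
  expand : ∀ c₁ c₂ a₁ a₂ → c₁ * c₂ + (a₁ * (c₂ + a₂) + a₂ * (c₁ + a₁)) ≡ a₁ * a₂ + (c₁ + a₁) * (c₂ + a₂)
  expand = solve-∀

-- The reflection: modulo n = 5 + 2(j+q), the outermost factor (2i-2)(2i+1)
-- of s (j+1), at i = j + 1, is (-(2q+5))·(-(2q+2)) ≡ pairRatio q; peeling
-- factors off both sides gives s (j+1) ≡ horner pairRatio q j.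
s-horner : ∀ j q n .{{_ : NonZero n}} → n ≡ 5 + 2 * (j + q) → s (suc j) % n ≡ horner pairRatio q j % n
s-horner zero q n n≡ = refl
s-horner (suc j) q n n≡ = begin
  (factor * s (suc j) + 1) % n                        ≡⟨ +-cong-% n (*-cong-% n factor≡ratio (s-horner j (suc q) n n≡′)) refl ⟩
  (pairRatio q * horner pairRatio (suc q) j + 1) % n  ≡⟨ cong (_% n) (+-comm _ 1) ⟩
  horner pairRatio q (suc j) % n                      ∎
  where
  i : ℕ
  i = suc (suc j)
  factor : ℕ
  factor = (2 * i ∸ 2) * (2 * i + 1)
  first-complement : ∀ j q → 2 * j + 2 + (2 * q + 5) ≡ 5 + 2 * (suc j + q)
  first-complement = solve-∀
  second-complement : ∀ j q → 2 * suc (suc j) + 1 + (2 * q + 2) ≡ 5 + 2 * (suc j + q)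
  second-complement = solve-∀
  shift : ∀ j q → 5 + 2 * (suc j + q) ≡ 5 + 2 * (j + suc q)
  shift = solve-∀
  minus-two : 2 * i ∸ 2 ≡ 2 * j + 2
  minus-two = cong (_∸ 2) (index j)
    where
    index : ∀ j → 2 * suc (suc j) ≡ 2 + (2 * j + 2)
    index = solve-∀
  factor≡ratio : factor % n ≡ pairRatio q % n
  factor≡ratio = complements-product (2 * i ∸ 2) (2 * i + 1) (2 * q + 5) (2 * q + 2) n
    (trans (cong (_+ (2 * q + 5)) minus-two) (trans (first-complement j q) (sym n≡)))
    (trans (second-complement j q) (sym n≡))
  n≡′ : n ≡ 5 + 2 * (j + suc q)
  n≡′ = trans n≡ (shift j q)

factSum-mod : ∀ j → factSum (5 + 2 * j) % (5 + 2 * j) ≡ (1 + 3 * s (suc j)) % (5 + 2 * j)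
factSum-mod j = begin
  factSum p % p                                     ≡⟨ cong (λ k → factSum k % p) (modulus j) ⟨
  factSum (3 + 2 * suc j) % p                       ≡⟨ cong (_% p) (factSum-pairs (suc j)) ⟩
  (1 + sumFrom pair 0 (suc j)) % p                  ≡⟨ cong (λ z → (1 + z) % p) (sumFrom-snoc pair 0 j) ⟩
  (1 + (sumFrom pair 0 j + pair (suc j))) % p       ≡⟨ cong (_% p) (+-assoc 1 (sumFrom pair 0 j) (pair (suc j))) ⟨
  (1 + sumFrom pair 0 j + pair (suc j)) % p         ≡⟨ %-remove-+ʳ (1 + sumFrom pair 0 j) p∣lastPair ⟩
  (1 + sumFrom pair 0 j) % p                        ≡⟨ cong (λ z → (1 + z) % p) (sumFrom-horner pair pairRatio pair-step 0 j) ⟩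
  (1 + 3 * horner pairRatio 0 j) % p                ≡⟨ tripled ⟩
  (1 + 3 * s (suc j)) % p                           ∎
  where
  p : ℕ
  p = 5 + 2 * j
  modulus : ∀ j → 3 + 2 * suc j ≡ 5 + 2 * j
  modulus = solve-∀
  p∣lastPair : p ∣ pair (suc j)
  p∣lastPair = subst (_∣ pair (suc j)) (trans (+-comm _ 3) (modulus j)) (pair-divisible (suc j))
  horner≡s : horner pairRatio 0 j % p ≡ s (suc j) % p
  horner≡s = sym (s-horner j 0 p (cong (λ k → 5 + 2 * k) (sym (+-identityʳ j))))
  tripled : (1 + 3 * horner pairRatio 0 j) % p ≡ (1 + 3 * s (suc j)) % p
  tripled = +-cong-% {1} {1} {3 * horner pairRatio 0 j} {3 * s (suc j)} p refl
              (*-cong-% {3} {3} {horner pairRatio 0 j} {s (suc j)} p refl horner≡s)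

prime≥5-form : ∀ {p} → Prime p → 5 ≤ p → ∃ λ j → p ≡ 5 + 2 * j
prime≥5-form {p} pp 5≤p = byParity (p % 2) (p / 2) (m≡m%n+[m/n]*n p 2) (m%n<n p 2)
  where
  byParity : ∀ r k → p ≡ r + k * 2 → r < 2 → ∃ λ j → p ≡ 5 + 2 * j
  byParity zero k p≡ _ with prime⇒irreducible pp (divides k p≡)
  ... | inj₁ ()
  ... | inj₂ 2≡p = ⊥-elim (<⇒≱ (s≤s (s≤s (s≤s z≤n))) (subst (5 ≤_) (sym 2≡p) 5≤p))
  byParity 1 zero p≡ _ = ⊥-elim (<⇒≱ (s≤s (s≤s z≤n)) (subst (5 ≤_) p≡ 5≤p))
  byParity 1 1 p≡ _ = ⊥-elim (<⇒≱ (s≤s (s≤s (s≤s (s≤s z≤n)))) (subst (5 ≤_) p≡ 5≤p))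
  byParity 1 (suc (suc j)) p≡ _ = j , trans p≡ (odd j)
    where
    odd : ∀ j → 1 + suc (suc j) * 2 ≡ 5 + 2 * j
    odd = solve-∀
  byParity (suc (suc r)) k _ (s≤s (s≤s ()))

mainTheorem3 : (p : ℕ) → (pp : Prime p) → 5 ≤ p →
    _%_ (factSum p) p {{prime⇒nonZero pp}} ≡ _%_ (1 + 3 * s ((p ∸ 3) / 2)) p {{prime⇒nonZero pp}}
mainTheorem3 p pp 5≤p with prime≥5-form pp 5≤p
... | j , refl = begin
  factSum (5 + 2 * j) % (5 + 2 * j)                 ≡⟨ factSum-mod j ⟩
  (1 + 3 * s (suc j)) % (5 + 2 * j)                 ≡⟨ cong (λ m → (1 + 3 * s m) % (5 + 2 * j)) half ⟨
  (1 + 3 * s ((2 + 2 * j) / 2)) % (5 + 2 * j)       ∎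
  where
  half : (2 + 2 * j) / 2 ≡ suc j
  half = trans (cong (_/ 2) (double j)) (m*n/n≡m (suc j) 2)
    where
    double : ∀ j → 2 + 2 * j ≡ suc j * 2
    double = solve-∀
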